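{- Let $p$, $p^*$ and $q$ be three distinct primes, and let $k,k^*$ be positive integers with $p^{k-1}\,\|\,(q-1)$ and $(p^*)^{k^*-1}\,\|\,(q-1)$. Let $a,a^*$ be positive integers with $p\mid\sigma(q^{2a})$ and $p^*\mid\sigma(q^{2a^*})$. Let $f_{p}^{q}$ be the smallest odd positive integer greater than $1$ with $q^{f_p^q}\equiv 1\pmod{p^{k}}$, and $f_{p^*}^{q}$ the smallest odd positive integer greater than $1$ with $q^{f_{p^*}^q}\equiv 1\pmod{(p^*)^{k^*}}$. If $f_{p^*}^{q}\mid f_{p}^{q}$, then $pp^*\mid\sigma(q^{2a})$.
   Context: $\sigma(n)$ denotes the sum of the positive divisors of $n$. The notation $p^{j}\,\|\,m$ means $p^j\mid m$ and $p^{j+1}\nmid m$. -}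

module Defs where

open import Data.Nat using (ℕ; zero; suc; _+_; _*_; _^_; _<_; _≤_)
open import Data.Nat.Divisibility using (_∣_; _∣?_)
open import Data.List using (List; filter; upTo; map)
open import Data.Nat.ListAction using (sum)
open import Data.Product using (_×_)
open import Relation.Nullary using (¬_)
open import Relation.Binary.PropositionalEquality using (_≡_)

-- σ(n): sum of the positive divisors of n (σ 0 = 0 by this convention; unused).
σ : ℕ → ℕ
σ n = sum (filter (_∣? n) (map suc (upTo n)))

_^_∥_ : ℕ → ℕ → ℕ → Set
p ^ j ∥ m = (p ^ j ∣ m) × ¬ (p ^ suc j ∣ m)

Odd : ℕ → Set
Odd n = ¬ (2 ∣ n)

-- q^f ≡ 1 (mod m), written as  m ∣ q^f - 1  with q ≥ 1, i.e. q^f ≡ 1 + m*t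
-- we use the stdlib-style: m divides (q ^ f ∸ 1); for q ≥ 1 this is exact.
open import Data.Nat using (_∸_)
CongOne : ℕ → ℕ → ℕ → Set
CongOne q f m = m ∣ (q ^ f ∸ 1)

IsLeastOddOrder : ℕ → ℕ → ℕ → Set
IsLeastOddOrder q m f =
  (Odd f × 1 < f × CongOne q f m) ×
  (∀ g → Odd g → 1 < g → CongOne q g m → f ≤ g)

-- Since (q − 1) σ(q^n) = q^(n+1) − 1 and p^(k−1) ∥ q − 1, a prime p divides σ(q^(2a)) exactly
-- when q^(2a+1) ≡ 1 (mod p^k).  As q ≢ 1 (mod p^k), the least odd exponent f > 1 with
-- q^f ≡ 1 (mod p^k) divides every n with q^n ≡ 1: by Bézout, gcd(n, f) is again such an
-- exponent, it is odd as a divisor of f and it is not 1, so it equals f.  Thus p ∣ σ(q^(2a))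
-- gives f_p ∣ 2a+1, hence f_p* ∣ 2a+1, hence p* ∣ σ(q^(2a)), and the distinct primes p, p*
-- both divide it.
module Submission where

open import Defs
open import Data.Nat.Base
  using (ℕ; zero; suc; _+_; _*_; _^_; _∸_; _≤_; _<_; z≤n; s≤s; NonZero; >-nonZero; nonTrivial⇒n>1)
open import Data.Nat.Properties
open import Data.Nat.Divisibility
open import Data.Nat.Primality
  using (Prime; prime⇒irreducible; prime⇒nonZero; prime⇒nonTrivial; ¬prime[0]; ¬prime[1]; euclidsLemma)
open import Data.Nat.Coprimality using (Coprime; coprime-divisor)
open import Data.Nat.GCD using (gcd; gcd-GCD; gcd[m,n]∣m; gcd[m,n]∣n; module Bézout)
open import Data.Nat.ListAction using (sum)
open import Data.Nat.ListAction.Properties using (sum-++)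
open import Data.Nat.Tactic.RingSolver using (solve-∀)
open import Data.List.Base using (List; []; [_]; _++_; _∷ʳ_; filter; map; upTo)
open import Data.List.Properties
  using (upTo-∷ʳ; map-++; filter-++; filter-accept; filter-reject; ++-identityʳ)
open import Data.Product.Base using (_,_)
open import Data.Sum.Base using (_⊎_; inj₁; inj₂)
open import Function.Base using (_∘_)
open import Function.Bundles using (_⇔_; mk⇔; module Equivalence)
open import Relation.Nullary using (¬_; yes; no; contradiction)
open import Relation.Binary.PropositionalEquality
  using (_≡_; _≢_; refl; sym; trans; cong; cong₂; subst; subst₂; module ≡-Reasoning)

open Equivalence using (to; from)

divisorsUpTo : ℕ → ℕ → List ℕ
divisorsUpTo n b = filter (_∣? n) (map suc (upTo b))

divisorsUpTo-suc : ∀ n b →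
  divisorsUpTo n (suc b) ≡ divisorsUpTo n b ++ filter (_∣? n) [ suc b ]
divisorsUpTo-suc n b = begin
  filter (_∣? n) (map suc (upTo (suc b)))         ≡⟨ cong (filter (_∣? n) ∘ map suc) (upTo-∷ʳ b) ⟨
  filter (_∣? n) (map suc (upTo b ∷ʳ b))          ≡⟨ cong (filter (_∣? n)) (map-++ suc (upTo b) [ b ]) ⟩
  filter (_∣? n) (map suc (upTo b) ++ [ suc b ])  ≡⟨ filter-++ (_∣? n) (map suc (upTo b)) [ suc b ] ⟩
  divisorsUpTo n b ++ filter (_∣? n) [ suc b ]    ∎
  where open ≡-Reasoning

divisorsUpTo-accept : ∀ {n b} → suc b ∣ n → divisorsUpTo n (suc b) ≡ divisorsUpTo n b ∷ʳ suc b
divisorsUpTo-accept {n} {b} 1+b∣n =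
  trans (divisorsUpTo-suc n b) (cong (divisorsUpTo n b ++_) (filter-accept (_∣? n) 1+b∣n))

divisorsUpTo-reject : ∀ {n b} → ¬ suc b ∣ n → divisorsUpTo n (suc b) ≡ divisorsUpTo n b
divisorsUpTo-reject {n} {b} 1+b∤n = begin
  divisorsUpTo n (suc b)                        ≡⟨ divisorsUpTo-suc n b ⟩
  divisorsUpTo n b ++ filter (_∣? n) [ suc b ]  ≡⟨ cong (divisorsUpTo n b ++_) (filter-reject (_∣? n) 1+b∤n) ⟩
  divisorsUpTo n b ++ []                        ≡⟨ ++-identityʳ (divisorsUpTo n b) ⟩
  divisorsUpTo n b                              ∎
  where open ≡-Reasoning

divisorsUpTo-cong : ∀ {m n} b → (∀ {d} → d ≤ b → d ∣ m ⇔ d ∣ n) →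
  divisorsUpTo m b ≡ divisorsUpTo n b
divisorsUpTo-cong zero m⇔n = refl
divisorsUpTo-cong {m} {n} (suc b) m⇔n with suc b ∣? m
... | yes 1+b∣m = begin
  divisorsUpTo m (suc b)     ≡⟨ divisorsUpTo-accept 1+b∣m ⟩
  divisorsUpTo m b ∷ʳ suc b  ≡⟨ cong (_∷ʳ suc b) (divisorsUpTo-cong b (m⇔n ∘ m≤n⇒m≤1+n)) ⟩
  divisorsUpTo n b ∷ʳ suc b  ≡⟨ divisorsUpTo-accept (to (m⇔n ≤-refl) 1+b∣m) ⟨
  divisorsUpTo n (suc b)     ∎
  where open ≡-Reasoning
... | no 1+b∤m = begin
  divisorsUpTo m (suc b)  ≡⟨ divisorsUpTo-reject 1+b∤m ⟩
  divisorsUpTo m b        ≡⟨ divisorsUpTo-cong b (m⇔n ∘ m≤n⇒m≤1+n) ⟩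
  divisorsUpTo n b        ≡⟨ divisorsUpTo-reject (1+b∤m ∘ from (m⇔n ≤-refl)) ⟨
  divisorsUpTo n (suc b)  ∎
  where open ≡-Reasoning

divisorsUpTo-beyond : ∀ n b .{{_ : NonZero n}} → n ≤ b → divisorsUpTo n b ≡ divisorsUpTo n n
divisorsUpTo-beyond n zero    z≤n = refl
divisorsUpTo-beyond n (suc b) n≤1+b with m≤n⇒m<n∨m≡n n≤1+b
... | inj₂ refl      = refl
... | inj₁ (s≤s n≤b) = trans (divisorsUpTo-reject (>⇒∤ (s≤s n≤b))) (divisorsUpTo-beyond n b n≤b)

σ[n]≡σ[m]+n : ∀ m n .{{_ : NonZero m}} → m < n → (∀ {d} → d < n → d ∣ n ⇔ d ∣ m) →
  σ n ≡ σ m + n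
σ[n]≡σ[m]+n m (suc c) (s≤s m≤c) n⇔m = begin
  sum (divisorsUpTo (suc c) (suc c))          ≡⟨ cong sum (divisorsUpTo-accept {suc c} {c} ∣-refl) ⟩
  sum (divisorsUpTo (suc c) c ∷ʳ suc c)       ≡⟨ sum-++ (divisorsUpTo (suc c) c) [ suc c ] ⟩
  sum (divisorsUpTo (suc c) c) + (suc c + 0)  ≡⟨ cong₂ _+_ (cong sum (divisorsUpTo-cong c (n⇔m ∘ s≤s)))
                                                           (+-identityʳ (suc c)) ⟩
  sum (divisorsUpTo m c) + suc c              ≡⟨ cong (λ ds → sum ds + suc c) (divisorsUpTo-beyond m c m≤c) ⟩
  σ m + suc c                                 ∎
  where open ≡-Reasoning

prime∤⇒coprime : ∀ {p n} → Prime p → ¬ p ∣ n → Coprime n p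
prime∤⇒coprime pp p∤n (d∣n , d∣p) with prime⇒irreducible pp d∣p
... | inj₁ d≡1 = d≡1
... | inj₂ refl = contradiction d∣n p∤n

∣prime^1+e⇒∣prime^e⊎≡ : ∀ {p d} e → Prime p → d ∣ p ^ suc e → d ∣ p ^ e ⊎ d ≡ p ^ suc e
∣prime^1+e⇒∣prime^e⊎≡ {p} {d} e pp d∣p^1+e with p ∣? d
... | no p∤d = inj₁ (coprime-divisor (prime∤⇒coprime pp p∤d) d∣p^1+e)
... | yes (divides d′ refl) =
  times-p e (*-cancelʳ-∣ {d′} p (subst (d′ * p ∣_) (*-comm p (p ^ e)) d∣p^1+e))
  where
  instance _ = prime⇒nonZero pp
  times-p : ∀ e {d′} → d′ ∣ p ^ e → d′ * p ∣ p ^ e ⊎ d′ * p ≡ p ^ suc e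
  times-p zero         d′∣1     = inj₂ (trans (cong (_* p) (∣1⇒≡1 d′∣1)) (*-comm 1 p))
  times-p (suc e) {d′} d′∣p^1+e with ∣prime^1+e⇒∣prime^e⊎≡ e pp d′∣p^1+e
  ... | inj₁ d′∣p^e = inj₁ (subst (d′ * p ∣_) (*-comm (p ^ e) p) (*-monoˡ-∣ p d′∣p^e))
  ... | inj₂ refl   = inj₂ (*-comm (p ^ suc e) p)

σ[p^1+e]≡σ[p^e]+p^1+e : ∀ {p} → Prime p → ∀ e → σ (p ^ suc e) ≡ σ (p ^ e) + p ^ suc e
σ[p^1+e]≡σ[p^e]+p^1+e {p} pp e = σ[n]≡σ[m]+n (p ^ e) (p ^ suc e) p^e<p^1+e proper-divisors
  where
  instance
    _ = prime⇒nonZero pp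
    _ = prime⇒nonTrivial pp
    _ = m^n≢0 p e
  p^e<p^1+e : p ^ e < p ^ suc e
  p^e<p^1+e = subst (p ^ e <_) (*-comm (p ^ e) p) (m<m*n (p ^ e) p (nonTrivial⇒n>1 p))
  proper-divisors : ∀ {d} → d < p ^ suc e → d ∣ p ^ suc e ⇔ d ∣ p ^ e
  proper-divisors {d} d<p^1+e = mk⇔ below (∣n⇒∣m*n p)
    where
    below : d ∣ p ^ suc e → d ∣ p ^ e
    below d∣p^1+e with ∣prime^1+e⇒∣prime^e⊎≡ e pp d∣p^1+e
    ... | inj₁ d∣p^e = d∣p^e
    ... | inj₂ refl  = contradiction refl (<⇒≢ d<p^1+e)

[p∸1]*σ[p^n]≡p^1+n∸1 : ∀ {p} → Prime p → ∀ n → (p ∸ 1) * σ (p ^ n) ≡ p ^ suc n ∸ 1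
[p∸1]*σ[p^n]≡p^1+n∸1 {zero}  p0 _       = contradiction p0 ¬prime[0]
[p∸1]*σ[p^n]≡p^1+n∸1 {suc r} pp zero    = refl
[p∸1]*σ[p^n]≡p^1+n∸1 {suc r} pp (suc n) = begin
  r * σ (P * Pⁿ)                 ≡⟨ cong (r *_) (σ[p^1+e]≡σ[p^e]+p^1+e pp n) ⟩
  r * (σ Pⁿ + P * Pⁿ)            ≡⟨ *-distribˡ-+ r (σ Pⁿ) (P * Pⁿ) ⟩
  r * σ Pⁿ + r * (P * Pⁿ)        ≡⟨ cong (_+ r * (P * Pⁿ)) ([p∸1]*σ[p^n]≡p^1+n∸1 pp n) ⟩
  (P * Pⁿ ∸ 1) + r * (P * Pⁿ)    ≡⟨ +-∸-comm (r * (P * Pⁿ)) (m^n>0 P (suc n)) ⟨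
  P * Pⁿ + r * (P * Pⁿ) ∸ 1      ∎
  where
  open ≡-Reasoning
  P = suc r
  Pⁿ = P ^ n

m*n∸1≡m*[n∸1]+[m∸1] : ∀ m n .{{_ : NonZero n}} → m * n ∸ 1 ≡ m * (n ∸ 1) + (m ∸ 1)
m*n∸1≡m*[n∸1]+[m∸1] zero    (suc n) = refl
m*n∸1≡m*[n∸1]+[m∸1] (suc m) (suc n) = expand m n
  where
  expand : ∀ m n → n + m * suc n ≡ suc m * n + m
  expand = solve-∀

m^[n+o]∸1≡m^n*[m^o∸1]+[m^n∸1] : ∀ m n o .{{_ : NonZero m}} →
  m ^ (n + o) ∸ 1 ≡ m ^ n * (m ^ o ∸ 1) + (m ^ n ∸ 1)
m^[n+o]∸1≡m^n*[m^o∸1]+[m^n∸1] m n o =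
  trans (cong (_∸ 1) (^-distribˡ-+-* m n o)) (m*n∸1≡m*[n∸1]+[m∸1] (m ^ n) (m ^ o) {{m^n≢0 m o}})

module _ {q m : ℕ} .{{_ : NonZero q}} where

  CongOne-+ : ∀ x y → CongOne q x m → CongOne q y m → CongOne q (x + y) m
  CongOne-+ x y hx hy = subst (m ∣_) (sym (m^[n+o]∸1≡m^n*[m^o∸1]+[m^n∸1] q x y))
    (∣m∣n⇒∣m+n (∣n⇒∣m*n (q ^ x) hy) hx)

  CongOne-cancelʳ-+ : ∀ x y → CongOne q (x + y) m → CongOne q y m → CongOne q x m
  CongOne-cancelʳ-+ x y hx+y hy = ∣m+n∣m⇒∣n
    (subst (m ∣_) (m^[n+o]∸1≡m^n*[m^o∸1]+[m^n∸1] q x y) hx+y) (∣n⇒∣m*n (q ^ x) hy)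

  CongOne-* : ∀ s x → CongOne q x m → CongOne q (s * x) m
  CongOne-* zero    x hx = m ∣0
  CongOne-* (suc s) x hx = CongOne-+ x (s * x) hx (CongOne-* s x hx)

  CongOne-∣ : ∀ {x y} → x ∣ y → CongOne q x m → CongOne q y m
  CongOne-∣ (divides s refl) = CongOne-* s _

  CongOne-Bézout : ∀ g x y s t → g + t * y ≡ s * x → CongOne q x m → CongOne q y m → CongOne q g m
  CongOne-Bézout g x y s t g+ty≡sx hx hy = CongOne-cancelʳ-+ g (t * y)
    (subst (λ n → CongOne q n m) (sym g+ty≡sx) (CongOne-* s x hx)) (CongOne-* t y hy)

  CongOne-gcd : ∀ x y → CongOne q x m → CongOne q y m → CongOne q (gcd x y) m
  CongOne-gcd x y hx hy with Bézout.identity (gcd-GCD x y)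
  ... | Bézout.+- s t eq = CongOne-Bézout (gcd x y) x y s t eq hx hy
  ... | Bézout.-+ s t eq = CongOne-Bézout (gcd x y) y x t s eq hy hx

leastOddOrder-divisor : ∀ {q m f g} → IsLeastOddOrder q m f → ¬ CongOne q 1 m →
  g ∣ f → CongOne q g m → g ≡ f
leastOddOrder-divisor {g = zero} ((_ , 1<f , _) , _) _ 0∣f _ =
  contradiction (subst (1 <_) (0∣⇒≡0 0∣f) 1<f) λ ()
leastOddOrder-divisor {g = suc zero} _ q≢1 _ hg = contradiction hg q≢1
leastOddOrder-divisor {g = suc (suc _)} ((odd-f , 1<f , _) , least) _ g∣f hg =
  ≤-antisym (∣⇒≤ {{>-nonZero (<⇒≤ 1<f)}} g∣f)
            (least _ (λ 2∣g → odd-f (∣-trans 2∣g g∣f)) (s≤s (s≤s z≤n)) hg)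

leastOddOrder-∣ : ∀ {q m f} n .{{_ : NonZero q}} → IsLeastOddOrder q m f → ¬ CongOne q 1 m →
  CongOne q n m → f ∣ n
leastOddOrder-∣ {f = f} n lo@((_ , _ , hf) , _) q≢1 hn =
  subst (_∣ n) (leastOddOrder-divisor lo q≢1 (gcd[m,n]∣n n f) (CongOne-gcd n f hn hf)) (gcd[m,n]∣m n f)

∥⇒∣⇔^1+∣* : ∀ {p} j c s → Prime p → p ^ j ∥ c → p ∣ s ⇔ p ^ suc j ∣ c * s
∥⇒∣⇔^1+∣* {p} j .(c′ * p ^ j) s pp (divides c′ refl , pʲ⁺¹∤c) = mk⇔ lift lower
  where
  instance _ = m^n≢0 p j {{prime⇒nonZero pp}}
  regroup : c′ * p ^ j * s ≡ p ^ j * (c′ * s)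
  regroup = trans (cong (_* s) (*-comm c′ (p ^ j))) (*-assoc (p ^ j) c′ s)
  lift : p ∣ s → p ^ suc j ∣ c′ * p ^ j * s
  lift p∣s = subst (_∣ c′ * p ^ j * s) (*-comm (p ^ j) p) (*-pres-∣ (n∣m*n c′) p∣s)
  lower : p ^ suc j ∣ c′ * p ^ j * s → p ∣ s
  lower pʲ⁺¹∣cs with euclidsLemma c′ s pp
                      (*-cancelˡ-∣ (p ^ j) (subst₂ _∣_ (*-comm p (p ^ j)) regroup pʲ⁺¹∣cs))
  ... | inj₁ p∣c′ = contradiction (*-monoˡ-∣ (p ^ j) p∣c′) pʲ⁺¹∤c
  ... | inj₂ p∣s  = p∣s

∣σ[q^n]⇔CongOne : ∀ {p q} j n → Prime p → Prime q → p ^ j ∥ (q ∸ 1) →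
  p ∣ σ (q ^ n) ⇔ CongOne q (suc n) (p ^ suc j)
∣σ[q^n]⇔CongOne {p} {q} j n pp pq pʲ∥q-1 =
  subst (λ x → p ∣ σ (q ^ n) ⇔ p ^ suc j ∣ x) ([p∸1]*σ[p^n]≡p^1+n∸1 pq n)
        (∥⇒∣⇔^1+∣* j (q ∸ 1) (σ (q ^ n)) pp pʲ∥q-1)

∥⇒¬CongOne[1] : ∀ p q j → p ^ j ∥ (q ∸ 1) → ¬ CongOne q 1 (p ^ suc j)
∥⇒¬CongOne[1] p q j (_ , pʲ⁺¹∤q-1) hq =
  pʲ⁺¹∤q-1 (subst (λ x → p ^ suc j ∣ x ∸ 1) (*-identityʳ q) hq)

prime-*-∣ : ∀ {p m n} → Prime p → ¬ p ∣ m → p ∣ n → m ∣ n → p * m ∣ n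
prime-*-∣ {m = m} pp p∤m p∣um (divides u refl) with euclidsLemma u m pp p∣um
... | inj₁ p∣u = *-monoˡ-∣ m p∣u
... | inj₂ p∣m = contradiction p∣m p∤m

prime∤prime : ∀ {p p′} → Prime p → Prime p′ → p ≢ p′ → ¬ p ∣ p′
prime∤prime pp pp′ p≢p′ p∣p′ with prime⇒irreducible pp′ p∣p′
... | inj₁ refl = ¬prime[1] pp
... | inj₂ p≡p′ = p≢p′ p≡p′

corollary1p4 :
    (p p* q k k* a a* fp fp* : ℕ) →
    Prime p → Prime p* → Prime q →
    p ≢ p* → p ≢ q → p* ≢ q →
    0 < k → 0 < k* →
    p ^ (k ∸ 1) ∥ (q ∸ 1) → p* ^ (k* ∸ 1) ∥ (q ∸ 1) →
    0 < a → 0 < a* →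
    p ∣ σ (q ^ (2 * a)) → p* ∣ σ (q ^ (2 * a*)) →
    IsLeastOddOrder q (p ^ k) fp → IsLeastOddOrder q (p* ^ k*) fp* →
    fp* ∣ fp →
    p * p* ∣ σ (q ^ (2 * a))
corollary1p4 _ _ _ zero _ _ _ _ _ _ _ _ _ _ _ () _ _ _ _ _ _ _ _ _ _
corollary1p4 _ _ _ (suc _) zero _ _ _ _ _ _ _ _ _ _ _ () _ _ _ _ _ _ _ _ _
corollary1p4 p p* q (suc j) (suc j*) a _ fp fp* pp pp* pq p≢p* _ _ _ _ pʲ∥q-1 p*ʲ*∥q-1 _ _
             p∣σ _ lo ((_ , _ , q^fp*≡1) , _) fp*∣fp =
  prime-*-∣ pp (prime∤prime pp pp* p≢p*) p∣σ p*∣σ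
  where
  instance _ = prime⇒nonZero pq
  fp∣2a+1 : fp ∣ suc (2 * a)
  fp∣2a+1 = leastOddOrder-∣ (suc (2 * a)) lo (∥⇒¬CongOne[1] p q j pʲ∥q-1)
              (to (∣σ[q^n]⇔CongOne j (2 * a) pp pq pʲ∥q-1) p∣σ)
  p*∣σ : p* ∣ σ (q ^ (2 * a))
  p*∣σ = from (∣σ[q^n]⇔CongOne j* (2 * a) pp* pq p*ʲ*∥q-1)
              (CongOne-∣ (∣-trans fp*∣fp fp∣2a+1) q^fp*≡1)
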